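{- There is an absolute constant $c>0$ such that for all integers $2\le m\le n$ and every $m\times n$ matrix $A$ with entries $1,\dots,mn$ (each exactly once), procedure FillColumns on input $A$ performs at most $c\cdot mn\log n$ rotations in total and terminates with a configuration in which all columns are near-full.
   Context: Rows and columns are numbered from $1$. For $x\in\{1,\dots,mn\}$ let $\mathrm{col}(x)=((x-1)\bmod n)+1$ (its target column). $R$ denotes the first row and $C_j$ the $j$-th column; $R[j]$ and $C_j[i]$ denote the element at column $j$ of $R$, respectively at row $i$ of $C_j$; so $R[j]=C_j[1]$. "Rotate $R$" means a unit rightward rotation of the first row ($R[j]\to R[j+1]$ for $j<n$, $R[n]\to R[1]$). "Rotate $C_j$" means a unit downward rotation of column $j$ ($C_j[i]\to C_j[i+1]$ for $i<m$, $C_j[m]\to C_j[1]$). The body of $C_j$ consists of positions $C_j[2],\dots,C_j[m]$. A column $C_j$ is near-full if every element $x$ in its body has $\mathrm{col}(x)=j$, and underfull otherwise. Procedure FillColumns: while there exists an underfull column, do the following: for $j=1,\dots,n$ in order, while $\mathrm{col}(R[j])=j$ and $C_j$ is underfull, rotate $C_j$; after the for-loop, rotate $R$ once. -}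

module Defs where

open import Data.Nat using (ℕ; zero; suc; _+_; _*_; _∸_; _≡ᵇ_; _<_; _≤_; _<?_)
open import Data.Nat.DivMod using (_%_)
open import Data.Bool using (Bool; true; false; not; _∧_; if_then_else_)
open import Data.List using (List; []; _∷_; upTo; map)
open import Data.Bool.ListAction using (any)
open import Data.Maybe using (Maybe; just; nothing)
open import Data.Product using (_×_; _,_; ∃₂)
open import Data.Fin using (Fin; toℕ; fromℕ<)
open import Relation.Nullary using (yes; no)
open import Relation.Binary.PropositionalEquality using (_≡_)

-- Matrices are represented 0-based as functions ℕ → ℕ → ℕ; only the
-- entries (i , j) with i < m and j < n are meaningful.
-- Paper row i (1-based) = index i ∸ 1 here; paper column j = index j ∸ 1.
Mat : Set
Mat = ℕ → ℕ → ℕ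

toMat : (m n : ℕ) → (Fin m → Fin n → ℕ) → Mat
toMat m n A i j with i <? m | j <? n
... | yes p | yes q = A (fromℕ< p) (fromℕ< q)
... | _     | _     = 0

colOf : ℕ → ℕ → ℕ
colOf zero    x = 0
colOf (suc k) x = ((x ∸ 1) % suc k) + 1

rotC : (m : ℕ) → ℕ → Mat → Mat
rotC m j M i j' =
  if j' ≡ᵇ j
  then (if i ≡ᵇ 0 then M (m ∸ 1) j else M (i ∸ 1) j)
  else M i j'

rotR : (n : ℕ) → Mat → Mat
rotR n M i j =
  if i ≡ᵇ 0
  then (if j ≡ᵇ 0 then M 0 (n ∸ 1) else M 0 (j ∸ 1))
  else M i j

-- column with 0-based index j is underfull: some body element (rows 2..m,
-- i.e. 0-based indices 1..m-1) has target column ≠ j+1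
underfull : (m n : ℕ) → Mat → ℕ → Bool
underfull m n M j = any (λ i → not (colOf n (M i j) ≡ᵇ suc j)) (map suc (upTo (m ∸ 1)))

existsUnderfull : (m n : ℕ) → Mat → Bool
existsUnderfull m n M = any (underfull m n M) (upTo n)

topOK : (n : ℕ) → Mat → ℕ → Bool
topOK n M j = colOf n (M 0 j) ≡ᵇ suc j

-- Executions with fuel: `just (M' , r)` means the loop terminated within
-- the fuel, producing M' after exactly r rotations; `nothing` = out of fuel.

innerLoop : (m n : ℕ) → ℕ → Mat → ℕ → Maybe (Mat × ℕ)
innerLoop m n zero     M j = nothing
innerLoop m n (suc f)  M j with topOK n M j ∧ underfull m n M j
... | false = just (M , 0)
... | true with innerLoop m n f (rotC m j M) j
...   | nothing        = nothing
...   | just (M' , r)  = just (M' , suc r)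

forLoop : (m n : ℕ) → ℕ → Mat → List ℕ → Maybe (Mat × ℕ)
forLoop m n f M []       = just (M , 0)
forLoop m n f M (j ∷ js) with innerLoop m n f M j
... | nothing = nothing
... | just (M₁ , r₁) with forLoop m n f M₁ js
...   | nothing = nothing
...   | just (M₂ , r₂) = just (M₂ , r₁ + r₂)

fillColumns : (m n : ℕ) → ℕ → Mat → Maybe (Mat × ℕ)
fillColumns m n zero    M = nothing
fillColumns m n (suc f) M with existsUnderfull m n M
... | false = just (M , 0)
... | true with forLoop m n f M (upTo n)
...   | nothing = nothing
...   | just (M₁ , r₁) with fillColumns m n f (rotR n M₁)
...     | nothing = nothing
...     | just (M₂ , r₂) = just (M₂ , r₁ + suc r₂)

IsPermMatrix : (m n : ℕ) → (Fin m → Fin n → ℕ) → Set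
IsPermMatrix m n A =
    (∀ i j → 1 ≤ A i j × A i j ≤ m * n)
  × (∀ i j i' j' → A i j ≡ A i' j' → (i ≡ i' × j ≡ j'))
  × (∀ x → 1 ≤ x → x ≤ m * n → ∃₂ λ i j → A i j ≡ x)

AllNearFull : (m n : ℕ) → Mat → Set
AllNearFull m n M = (i : Fin m) (j : Fin n) → 1 ≤ toℕ i → colOf n (M (toℕ i) (toℕ j)) ≡ suc (toℕ j)

{-# OPTIONS --safe #-}
module Submission where

{-
Column rotations are paid for by the deficit of a column, the number of body cells below
the run of fitting entries at the top of its body: every rotation of the column extends
that run by one, so there are at most n·k ≤ mn of them in total.

Row rotations are counted through the number W of misfitting body entries, which never
grows. Within n consecutive outer iterations every first-row entry aimed at column t
reaches slot t, as it fits nowhere before, and each arrival at a column that still has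
misfits removes one of them. Only m values are aimed at t, so at most W_t + 1 first-row
entries are; summing over the columns gives W ≤ 2k·(decrease of W over these n
iterations). Hence W halves every 2kn iterations and vanishes after O(kn log n) of them,
and then every column is near-full.
-}

open import Defs
open import Data.Bool using (Bool; true; false; not; _∧_; if_then_else_)
open import Data.Bool.ListAction using (any; or)
open import Data.Bool.Properties using (T-≡)
open import Data.Fin using (Fin; toℕ; fromℕ<)
open import Data.Fin.Properties using (toℕ<n; fromℕ<-injective)
open import Data.List using (List; []; _∷_; map; upTo; applyUpTo)
open import Data.List.Membership.Propositional using (_∈_; _∉_)
open import Data.List.Membership.Propositional.Properties using (∈-upTo⁺)
open import Data.List.Properties using (map-upTo; map-cong)
open import Data.List.Relation.Unary.All as All using (All; []; _∷_)
open import Data.List.Relation.Unary.All.Properties using (applyUpTo⁺₁)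
open import Data.List.Relation.Unary.AllPairs using (_∷_)
open import Data.List.Relation.Unary.Any using (here; there)
open import Data.List.Relation.Unary.Unique.Propositional using (Unique)
open import Data.List.Relation.Unary.Unique.Propositional.Properties using (upTo⁺)
open import Data.Maybe using (just)
open import Data.Nat using (ℕ; zero; suc; _+_; _*_; _∸_; _^_; _⊓_; _≡ᵇ_; _≤_; _<_; z≤n; s≤s; z<s; s<s; NonZero)
open import Data.Nat.DivMod using (_%_; _/_; m≡m%n+[m/n]*n; m<n*o⇒m/o<n; m%n<n)
open import Data.Nat.GeneralisedArithmetic using (fold; fold-+; iterate; iterate-is-fold)
open import Data.Nat.Logarithm using (⌊log₂_⌋; ⌊log₂⌋-mono-≤; ⌊log₂[2^n]⌋≡n)
open import Data.Nat.Properties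
open import Algebra.Properties.CommutativeSemigroup +-commutativeSemigroup using (interchange)
open import Data.Nat.Tactic.RingSolver using (solve-∀)
open import Data.Product using (∃; _×_; _,_; proj₁; proj₂; map₂)
open import Data.Sum using (inj₁; inj₂)
open import Function using (_∘_; case_of_; Equivalence)
open import Relation.Binary.PropositionalEquality
open import Relation.Nullary using (yes; no; contradiction)

any-applyUpTo≡false⇒ : ∀ (p : ℕ → Bool) f a → any p (applyUpTo f a) ≡ false →
                       ∀ i → i < a → p (f i) ≡ false
any-applyUpTo≡false⇒ p f (suc a) none i i<a with p (f 0) in pf0
any-applyUpTo≡false⇒ p f (suc a) none zero    _         | false = pf0
any-applyUpTo≡false⇒ p f (suc a) none (suc i) (s<s i<a) | false = any-applyUpTo≡false⇒ p (f ∘ suc) a none i i<a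

any-applyUpTo≡false⇐ : ∀ (p : ℕ → Bool) f a → (∀ i → i < a → p (f i) ≡ false) →
                       any p (applyUpTo f a) ≡ false
any-applyUpTo≡false⇐ p f zero    none = refl
any-applyUpTo≡false⇐ p f (suc a) none rewrite none 0 z<s =
  any-applyUpTo≡false⇐ p (f ∘ suc) a (λ i i<a → none (suc i) (s<s i<a))

≡ᵇ-refl : ∀ x → (x ≡ᵇ x) ≡ true
≡ᵇ-refl x = Equivalence.to T-≡ (≡⇒≡ᵇ x x refl)

≡ᵇ≡true⇒≡ : ∀ x y → (x ≡ᵇ y) ≡ true → x ≡ y
≡ᵇ≡true⇒≡ x y = ≡ᵇ⇒≡ x y ∘ Equivalence.from T-≡

≢⇒≡ᵇ≡false : ∀ {x y} → x ≢ y → (x ≡ᵇ y) ≡ false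
≢⇒≡ᵇ≡false {x} {y} x≢y with x ≡ᵇ y in e
... | true  = contradiction (≡ᵇ≡true⇒≡ x y e) x≢y
... | false = refl

-- Finite sums and counting over initial segments of ℕ

𝟙 : Bool → ℕ
𝟙 true  = 1
𝟙 false = 0

∑< : ℕ → (ℕ → ℕ) → ℕ
∑< zero    f = 0
∑< (suc a) f = f 0 + ∑< a (f ∘ suc)

syntax ∑< a (λ i → e) = ∑[ i < a ] e

count : ℕ → (ℕ → Bool) → ℕ
count a P = ∑[ i < a ] 𝟙 (P i)

∑-cong : ∀ a {f g : ℕ → ℕ} → (∀ i → i < a → f i ≡ g i) → ∑< a f ≡ ∑< a g
∑-cong zero    f≡g = refl
∑-cong (suc a) f≡g = cong₂ _+_ (f≡g 0 z<s) (∑-cong a (λ i i<a → f≡g (suc i) (s<s i<a)))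

∑-mono-≤ : ∀ a {f g : ℕ → ℕ} → (∀ i → i < a → f i ≤ g i) → ∑< a f ≤ ∑< a g
∑-mono-≤ zero    f≤g = z≤n
∑-mono-≤ (suc a) f≤g = +-mono-≤ (f≤g 0 z<s) (∑-mono-≤ a (λ i i<a → f≤g (suc i) (s<s i<a)))

∑-distrib-+ : ∀ a (f g : ℕ → ℕ) → ∑[ i < a ] (f i + g i) ≡ ∑< a f + ∑< a g
∑-distrib-+ zero    f g = refl
∑-distrib-+ (suc a) f g = trans (cong (f 0 + g 0 +_) (∑-distrib-+ a (f ∘ suc) (g ∘ suc)))
                                (interchange (f 0) (g 0) _ _)

∑-const : ∀ a c → ∑[ i < a ] c ≡ a * c
∑-const zero    c = refl
∑-const (suc a) c = cong (c +_) (∑-const a c)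

∑-distribˡ-* : ∀ a c (f : ℕ → ℕ) → ∑[ i < a ] (c * f i) ≡ c * ∑< a f
∑-distribˡ-* zero    c f = sym (*-zeroʳ c)
∑-distribˡ-* (suc a) c f = trans (cong (c * f 0 +_) (∑-distribˡ-* a c (f ∘ suc)))
                                 (sym (*-distribˡ-+ c (f 0) _))

∑-comm : ∀ a b (f : ℕ → ℕ → ℕ) → ∑[ i < a ] ∑[ j < b ] f i j ≡ ∑[ j < b ] ∑[ i < a ] f i j
∑-comm zero    b f = sym (trans (∑-const b 0) (*-zeroʳ b))
∑-comm (suc a) b f = trans (cong (∑[ j < b ] f 0 j +_) (∑-comm a b (f ∘ suc)))
                           (sym (∑-distrib-+ b (f 0) (λ j → ∑[ i < a ] f (suc i) j)))

∑-last : ∀ a (f : ℕ → ℕ) → ∑< (suc a) f ≡ ∑< a f + f a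
∑-last zero    f = +-identityʳ (f 0)
∑-last (suc a) f = trans (cong (f 0 +_) (∑-last a (f ∘ suc))) (sym (+-assoc (f 0) _ _))

∑-ones : ∀ a → ∑[ i < a ] 1 ≡ a
∑-ones a = trans (∑-const a 1) (*-identityʳ a)

∑≡0⇒ : ∀ a (f : ℕ → ℕ) → ∑< a f ≡ 0 → ∀ i → i < a → f i ≡ 0
∑≡0⇒ (suc a) f ∑≡0 zero    _       = m+n≡0⇒m≡0 (f 0) ∑≡0
∑≡0⇒ (suc a) f ∑≡0 (suc i) (s<s i<a) = ∑≡0⇒ a (f ∘ suc) (m+n≡0⇒n≡0 (f 0) ∑≡0) i i<a

∑-update : ∀ a j d {f g : ℕ → ℕ} → j < a → f j + d ≡ g j → (∀ i → i < a → i ≢ j → f i ≡ g i) →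
           ∑< a f + d ≡ ∑< a g
∑-update (suc a) zero    d {f} {g} _ fj+d≡gj rest = begin
  f 0 + ∑< a (f ∘ suc) + d   ≡⟨ +-assoc (f 0) _ d ⟩
  f 0 + (∑< a (f ∘ suc) + d) ≡⟨ cong (f 0 +_) (+-comm _ d) ⟩
  f 0 + (d + ∑< a (f ∘ suc)) ≡⟨ sym (+-assoc (f 0) d _) ⟩
  f 0 + d + ∑< a (f ∘ suc)   ≡⟨ cong₂ _+_ fj+d≡gj (∑-cong a (λ i i<a → rest (suc i) (s<s i<a) (λ ()))) ⟩
  g 0 + ∑< a (g ∘ suc)       ∎
  where open ≡-Reasoning
∑-update (suc a) (suc j) d {f} {g} (s<s j<a) fj+d≡gj rest = begin
  f 0 + ∑< a (f ∘ suc) + d   ≡⟨ +-assoc (f 0) _ d ⟩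
  f 0 + (∑< a (f ∘ suc) + d) ≡⟨ cong₂ _+_ (rest 0 z<s (λ ()))
                                   (∑-update a j d j<a fj+d≡gj
                                     (λ i i<a i≢j → rest (suc i) (s<s i<a) (i≢j ∘ suc-injective))) ⟩
  g 0 + ∑< a (g ∘ suc)       ∎
  where open ≡-Reasoning

count-≤ : ∀ a (P : ℕ → Bool) → count a P ≤ a
count-≤ a P = ≤-trans (∑-mono-≤ a (λ i _ → 𝟙≤1 (P i))) (≤-reflexive (∑-ones a))
  where
  𝟙≤1 : ∀ b → 𝟙 b ≤ 1
  𝟙≤1 true  = ≤-refl
  𝟙≤1 false = z≤n

count-complement : ∀ a (P : ℕ → Bool) → count a P + count a (not ∘ P) ≡ a
count-complement a P = begin
  count a P + count a (not ∘ P)      ≡⟨ ∑-distrib-+ a (𝟙 ∘ P) (𝟙 ∘ not ∘ P) ⟨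
  ∑[ i < a ] (𝟙 (P i) + 𝟙 (not (P i))) ≡⟨ ∑-cong a (λ i _ → 𝟙+𝟙not≡1 (P i)) ⟩
  ∑[ i < a ] 1                       ≡⟨ ∑-ones a ⟩
  a                                  ∎
  where
  open ≡-Reasoning
  𝟙+𝟙not≡1 : ∀ b → 𝟙 b + 𝟙 (not b) ≡ 1
  𝟙+𝟙not≡1 true  = refl
  𝟙+𝟙not≡1 false = refl

count≡0⇒ : ∀ a (P : ℕ → Bool) → count a P ≡ 0 → ∀ i → i < a → P i ≡ false
count≡0⇒ a P count≡0 i i<a with P i | ∑≡0⇒ a (𝟙 ∘ P) count≡0 i i<a
... | false | _ = refl

count≡0⇐ : ∀ a (P : ℕ → Bool) → (∀ i → i < a → P i ≡ false) → count a P ≡ 0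
count≡0⇐ a P none = trans (∑-cong a (λ i i<a → cong 𝟙 (none i i<a))) (trans (∑-const a 0) (*-zeroʳ a))

count>0 : ∀ a (P : ℕ → Bool) i → i < a → P i ≡ true → 0 < count a P
count>0 (suc a) P zero    _         P0 rewrite P0 = z<s
count>0 (suc a) P (suc i) (s<s i<a) Pi = ≤-trans (count>0 a (P ∘ suc) i i<a Pi) (m≤n+m _ (𝟙 (P 0)))

remove : (ℕ → Bool) → ℕ → ℕ → Bool
remove Q j x = if x ≡ᵇ j then false else Q x

count-remove : ∀ b (Q : ℕ → Bool) j → j < b → Q j ≡ true → count b Q ≡ suc (count b (remove Q j))
count-remove (suc b) Q zero    _         Q0 rewrite Q0 = refl
count-remove (suc b) Q (suc j) (s<s j<b) Qj =
  trans (cong (𝟙 (Q 0) +_) (count-remove b (Q ∘ suc) j j<b Qj)) (+-suc _ _)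

record Injects (a : ℕ) (P : ℕ → Bool) (b : ℕ) (Q : ℕ → Bool) : Set where
  field
    to        : ℕ → ℕ
    maps-into : ∀ i → i < a → P i ≡ true → to i < b × Q (to i) ≡ true
    injective : ∀ i i′ → i < a → i′ < a → P i ≡ true → P i′ ≡ true → to i ≡ to i′ → i ≡ i′

open Injects

Injects-tail : ∀ {a b P Q} → Injects (suc a) P b Q → Injects a (P ∘ suc) b Q
Injects-tail ι = record
  { to        = to ι ∘ suc
  ; maps-into = λ i i<a → maps-into ι (suc i) (s<s i<a)
  ; injective = λ i i′ i<a i′<a Pi Pi′ →
                  suc-injective ∘ injective ι (suc i) (suc i′) (s<s i<a) (s<s i′<a) Pi Pi′
  }

Injects-remove : ∀ {a b P Q} (ι : Injects a P b Q) j → (∀ i → i < a → P i ≡ true → to ι i ≢ j) →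
                 Injects a P b (remove Q j)
Injects-remove {b = b} {Q = Q} ι j avoids = record
  { to        = to ι
  ; maps-into = λ i i<a Pi → keep (maps-into ι i i<a Pi) (avoids i i<a Pi)
  ; injective = injective ι
  }
  where
  keep : ∀ {x} → x < b × Q x ≡ true → x ≢ j → x < b × remove Q j x ≡ true
  keep (x<b , Qx) x≢j rewrite ≢⇒≡ᵇ≡false x≢j = x<b , Qx

Injects⇒tail-avoids-head : ∀ {a b P Q} (ι : Injects (suc a) P b Q) → P 0 ≡ true →
                          ∀ i → i < a → P (suc i) ≡ true → to ι (suc i) ≢ to ι 0
Injects⇒tail-avoids-head ι P0 i i<a Pi fi≡f0 = case injective ι (suc i) 0 (s<s i<a) z<s Pi P0 fi≡f0 of λ ()

count-injection : ∀ a {b} {P Q : ℕ → Bool} → Injects a P b Q → count a P ≤ count b Q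
count-injection zero    ι = z≤n
count-injection (suc a) {b} {P} {Q} ι with P 0 in P0
... | false = count-injection a (Injects-tail ι)
... | true  = begin
  suc (count a (P ∘ suc))           ≤⟨ s≤s (count-injection a (Injects-remove (Injects-tail ι) (to ι 0)
                                                                (Injects⇒tail-avoids-head ι P0))) ⟩
  suc (count b (remove Q (to ι 0))) ≡⟨ count-remove b Q (to ι 0) (proj₁ head) (proj₂ head) ⟨
  count b Q                         ∎
  where
  open ≤-Reasoning
  head = maps-into ι 0 z<s P0

count-injection₂ : ∀ a b {c} {P P′ Q : ℕ → Bool} (ι : Injects a P c Q) (ι′ : Injects b P′ c Q) →
                   (∀ i i′ → i < a → i′ < b → P i ≡ true → P′ i′ ≡ true → to ι i ≢ to ι′ i′) →
                   count a P + count b P′ ≤ count c Q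
count-injection₂ zero    b ι ι′ disjoint = count-injection b ι′
count-injection₂ (suc a) b {c} {P} {P′} {Q} ι ι′ disjoint with P 0 in P0
... | false = count-injection₂ a b (Injects-tail ι) ι′ (λ i i′ i<a → disjoint (suc i) i′ (s<s i<a))
... | true  = begin
  suc (count a (P ∘ suc) + count b P′) ≤⟨ s≤s (count-injection₂ a b
                                              (Injects-remove (Injects-tail ι) (to ι 0) (Injects⇒tail-avoids-head ι P0))
                                              (Injects-remove ι′ (to ι 0)
                                                (λ i i<b P′i → ≢-sym (disjoint 0 i z<s i<b P0 P′i)))
                                              (λ i i′ i<a → disjoint (suc i) i′ (s<s i<a))) ⟩
  suc (count c (remove Q (to ι 0)))     ≡⟨ count-remove c Q (to ι 0) (proj₁ head) (proj₂ head) ⟨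
  count c Q                            ∎
  where
  open ≤-Reasoning
  head = maps-into ι 0 z<s P0

count-decrements : ∀ (w : ℕ → ℕ) (Q : ℕ → Bool) → (∀ i → w (suc i) ≤ w i ∸ 𝟙 (Q i)) →
                   ∀ L → w L ≤ w 0 ∸ count L Q
count-decrements w Q step zero    = ≤-refl
count-decrements w Q step (suc L) = begin
  w (suc L)                                       ≤⟨ count-decrements (w ∘ suc) (Q ∘ suc) (step ∘ suc) L ⟩
  w 1 ∸ count L (Q ∘ suc)                         ≤⟨ ∸-monoˡ-≤ (count L (Q ∘ suc)) (step 0) ⟩
  w 0 ∸ 𝟙 (Q 0) ∸ count L (Q ∘ suc)               ≡⟨ ∸-+-assoc (w 0) (𝟙 (Q 0)) _ ⟩
  w 0 ∸ count (suc L) Q                           ∎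
  where open ≤-Reasoning

-- Sequences decaying geometrically

module _ (V : ℕ → ℕ) (c : ℕ) .{{_ : NonZero c}} (decay : ∀ j → V j + c * V (suc j) ≤ c * V j) where

  decay⇒antitone : ∀ j d → V (j + d) ≤ V j
  decay⇒antitone j zero    = ≤-reflexive (cong V (+-identityʳ j))
  decay⇒antitone j (suc d) = begin
    V (j + suc d)   ≡⟨ cong V (+-suc j d) ⟩
    V (suc (j + d)) ≤⟨ *-cancelˡ-≤ c (≤-trans (m≤n+m _ _) (decay (j + d))) ⟩
    V (j + d)       ≤⟨ decay⇒antitone j d ⟩
    V j             ∎
    where open ≤-Reasoning

  decay⇒halving : ∀ j → V (j + c) + V (j + c) ≤ V j
  decay⇒halving j = *-cancelˡ-≤ c (≤-trans (≤-reflexive (*-distribˡ-+ c _ _)) (partial c ≤-refl))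
    where
    open ≤-Reasoning
    -- each of the c steps from j to j + c sheds at least a c-th of V (j + c)
    partial : ∀ d → d ≤ c → c * V (j + d) + d * V (j + c) ≤ c * V j
    partial zero    _   = ≤-reflexive (trans (+-identityʳ _) (cong (λ i → c * V i) (+-identityʳ j)))
    partial (suc d) d<c = begin
      c * V (j + suc d) + (V (j + c) + d * V (j + c))   ≤⟨ +-monoʳ-≤ (c * V (j + suc d)) (+-monoˡ-≤ _ Vj+c≤Vj+d) ⟩
      c * V (j + suc d) + (V (j + d) + d * V (j + c))   ≡⟨ cong (λ i → c * V i + (V (j + d) + d * V (j + c))) (+-suc j d) ⟩
      c * V (suc (j + d)) + (V (j + d) + d * V (j + c)) ≡⟨ +-assoc (c * V (suc (j + d))) _ _ ⟨
      c * V (suc (j + d)) + V (j + d) + d * V (j + c)   ≡⟨ cong (_+ d * V (j + c)) (+-comm (c * V (suc (j + d))) _) ⟩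
      V (j + d) + c * V (suc (j + d)) + d * V (j + c)   ≤⟨ +-monoˡ-≤ _ (decay (j + d)) ⟩
      c * V (j + d) + d * V (j + c)                     ≤⟨ partial d (<⇒≤ d<c) ⟩
      c * V j                                           ∎
      where
      Vj+c≤Vj+d : V (j + c) ≤ V (j + d)
      Vj+c≤Vj+d = begin
        V (j + c)             ≡⟨ cong V (trans (+-assoc j d (c ∸ d)) (cong (j +_) (m+[n∸m]≡n (<⇒≤ d<c)))) ⟨
        V (j + d + (c ∸ d))   ≤⟨ decay⇒antitone (j + d) (c ∸ d) ⟩
        V (j + d)             ∎

  decay⇒geometric : ∀ h → 2 ^ h * V (c * h) ≤ V 0
  decay⇒geometric zero    = ≤-reflexive (trans (+-identityʳ _) (cong V (*-zeroʳ c)))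
  decay⇒geometric (suc h) = begin
    2 ^ suc h * V (c * suc h)               ≡⟨ cong (λ i → 2 ^ suc h * V i) (trans (*-suc c h) (+-comm c (c * h))) ⟩
    2 * 2 ^ h * V (c * h + c)               ≡⟨ doubling (2 ^ h) (V (c * h + c)) ⟩
    2 ^ h * (V (c * h + c) + V (c * h + c)) ≤⟨ *-monoʳ-≤ (2 ^ h) (decay⇒halving (c * h)) ⟩
    2 ^ h * V (c * h)                       ≤⟨ decay⇒geometric h ⟩
    V 0                                     ∎
    where
    open ≤-Reasoning
    doubling : ∀ a x → 2 * a * x ≡ a * (x + x)
    doubling = solve-∀

  decay⇒vanishes : ∀ h → V 0 < 2 ^ h → V (c * h) ≡ 0
  decay⇒vanishes h V0<2^h with V (c * h) | decay⇒geometric h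
  ... | zero  | _          = refl
  ... | suc v | 2^h*V≤V0 = contradiction (≤-trans (m≤m*n (2 ^ h) (suc v)) 2^h*V≤V0) (<⇒≱ V0<2^h)

column-budget : ∀ A B R → B ≤ A ∸ R → R ≤ suc A → R + (1 ⊓ A + (B + B)) ≤ 1 + (A + A)
column-budget zero B R B≤0∸R R≤1 rewrite n≤0⇒n≡0 (≤-trans B≤0∸R (≤-reflexive (0∸n≡0 R))) =
  ≤-trans (≤-reflexive (+-identityʳ R)) R≤1
column-budget (suc a) B R B≤A∸R R≤1+A with m≤n⇒m<n∨m≡n R≤1+A
... | inj₁ (s≤s R≤A) = begin
  R + (1 + (B + B))   ≡⟨ regroup R B ⟩
  1 + (B + R + B)     ≤⟨ +-monoʳ-≤ 1 (+-mono-≤ (m≤o∸n⇒m+n≤o B R≤A B≤A∸R)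
                                              (≤-trans B≤A∸R (m∸n≤m (suc a) R))) ⟩
  1 + (suc a + suc a) ∎
  where
  open ≤-Reasoning
  regroup : ∀ R B → R + (1 + (B + B)) ≡ 1 + (B + R + B)
  regroup = solve-∀
... | inj₂ refl rewrite n≤0⇒n≡0 (≤-trans B≤A∸R (≤-reflexive (m≤n⇒m∸n≡0 (n≤1+n a)))) = begin
  suc (suc a) + (1 + 0) ≡⟨ lhs a ⟩
  3 + a                 ≤⟨ +-monoʳ-≤ 3 (m≤n+m a a) ⟩
  3 + (a + a)           ≡⟨ rhs a ⟩
  1 + (suc a + suc a)   ∎
  where
  open ≤-Reasoning
  lhs : ∀ a → suc (suc a) + (1 + 0) ≡ 3 + a
  lhs = solve-∀
  rhs : ∀ a → 3 + (a + a) ≡ 1 + (suc a + suc a)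
  rhs = solve-∀

running-time-arithmetic : ∀ m n k L → 1 ≤ L → k ≤ m → n * k + 2 * k * (suc L + suc L) * n ≤ 9 * m * n * L
running-time-arithmetic m n k L 1≤L k≤m = begin
  n * k + 2 * k * (suc L + suc L) * n ≡⟨ lhs n k L ⟩
  n * k * (5 + 4 * L)                 ≤⟨ *-mono-≤ (*-monoʳ-≤ n k≤m) (+-monoˡ-≤ (4 * L) (*-monoʳ-≤ 5 1≤L)) ⟩
  n * m * (5 * L + 4 * L)             ≡⟨ rhs m n L ⟩
  9 * m * n * L                       ∎
  where
  open ≤-Reasoning
  lhs : ∀ n k L → n * k + 2 * k * (suc L + suc L) * n ≡ n * k * (5 + 4 * L)
  lhs = solve-∀
  rhs : ∀ m n L → n * m * (5 * L + 4 * L) ≡ 9 * m * n * L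
  rhs = solve-∀

-- The board: m = k + 1 rows, n columns

module Board (k n′ : ℕ) where

  m n : ℕ
  m = suc k
  n = suc n′

  belongsTo : ℕ → ℕ → Bool
  belongsTo x j = colOf n x ≡ᵇ suc j

  fits : Mat → ℕ → ℕ → Bool
  fits M i j = belongsTo (M i j) j

  misfits : Mat → ℕ → ℕ
  misfits M j = count k (λ i → not (fits M (suc i) j))

  totalMisfits : Mat → ℕ
  totalMisfits M = ∑[ j < n ] misfits M j

  fitRun : Mat → ℕ → ℕ → ℕ → ℕ
  fitRun M j i zero    = 0
  fitRun M j i (suc c) = if fits M i j then suc (fitRun M j (suc i) c) else 0

  deficit : Mat → ℕ → ℕ
  deficit M j = k ∸ fitRun M j 1 k

  totalDeficit : Mat → ℕ
  totalDeficit M = ∑[ j < n ] deficit M j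

  underfull≡false⇒ : ∀ M j → underfull m n M j ≡ false → ∀ i → i < k → not (fits M (suc i) j) ≡ false
  underfull≡false⇒ M j uf≡false =
    any-applyUpTo≡false⇒ (λ i → not (fits M i j)) suc k (trans (cong (any _) (sym (map-upTo suc k))) uf≡false)

  underfull≡false⇐ : ∀ M j → (∀ i → i < k → not (fits M (suc i) j) ≡ false) → underfull m n M j ≡ false
  underfull≡false⇐ M j allFit =
    trans (cong (any _) (map-upTo suc k)) (any-applyUpTo≡false⇐ (λ i → not (fits M i j)) suc k allFit)

  misfits>0⇒underfull : ∀ M j → 0 < misfits M j → underfull m n M j ≡ true
  misfits>0⇒underfull M j 0<misfits with underfull m n M j in uf
  ... | true  = refl
  ... | false = contradiction (count≡0⇐ k _ (underfull≡false⇒ M j uf)) (≢-sym (<⇒≢ 0<misfits))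

  misfits≡0⇒¬underfull : ∀ M j → misfits M j ≡ 0 → underfull m n M j ≡ false
  misfits≡0⇒¬underfull M j misfits≡0 = underfull≡false⇐ M j (count≡0⇒ k _ misfits≡0)

  fitRun-≤ : ∀ M j i c → fitRun M j i c ≤ c
  fitRun-≤ M j i zero = z≤n
  fitRun-≤ M j i (suc c) with fits M i j
  ... | true  = s≤s (fitRun-≤ M j (suc i) c)
  ... | false = z≤n

  fitRun-full : ∀ M j i c → fitRun M j i c ≡ c → ∀ r → r < c → fits M (i + r) j ≡ true
  fitRun-full M j i (suc c) full r r<c with fits M i j in fi
  fitRun-full M j i (suc c) full zero    _         | true = trans (cong (λ x → fits M x j) (+-identityʳ i)) fi
  fitRun-full M j i (suc c) full (suc r) (s<s r<c) | true =
    trans (cong (λ x → fits M x j) (+-suc i r)) (fitRun-full M j (suc i) c (suc-injective full) r r<c)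

  fitRun-truncate : ∀ M j i c → fitRun M j i (suc c) < suc c → fitRun M j i c ≡ fitRun M j i (suc c)
  fitRun-truncate M j i zero    run<c with fits M i j
  ... | true  = contradiction run<c (<-irrefl refl)
  ... | false = refl
  fitRun-truncate M j i (suc c) run<c with fits M i j
  ... | true  = cong suc (fitRun-truncate M j (suc i) c (≤-pred run<c))
  ... | false = refl

  underfull⇒fitRun<k : ∀ M j → underfull m n M j ≡ true → fitRun M j 1 k < k
  underfull⇒fitRun<k M j uf with m≤n⇒m<n∨m≡n (fitRun-≤ M j 1 k)
  ... | inj₁ run<k = run<k
  ... | inj₂ run≡k = contradiction (trans (sym uf) (underfull≡false⇐ M j allFit)) λ ()
    where
    allFit : ∀ i → i < k → not (fits M (suc i) j) ≡ false
    allFit i i<k = cong not (fitRun-full M j 1 k run≡k i i<k)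

  rotC-top : ∀ j M → rotC m j M 0 j ≡ M k j
  rotC-top j M rewrite ≡ᵇ-refl j = refl

  rotC-body : ∀ j M i → rotC m j M (suc i) j ≡ M i j
  rotC-body j M i rewrite ≡ᵇ-refl j = refl

  rotC-other : ∀ j M i {j′} → j′ ≢ j → rotC m j M i j′ ≡ M i j′
  rotC-other j M i j′≢j rewrite ≢⇒≡ᵇ≡false j′≢j = refl

  fits-rotC : ∀ j M i → fits (rotC m j M) (suc i) j ≡ fits M i j
  fits-rotC j M i = cong (λ x → belongsTo x j) (rotC-body j M i)

  fits-rotC-top : ∀ j M → fits (rotC m j M) 0 j ≡ fits M k j
  fits-rotC-top j M = cong (λ x → belongsTo x j) (rotC-top j M)

  fitRun-rotC : ∀ j M i c → fitRun (rotC m j M) j (suc i) c ≡ fitRun M j i c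
  fitRun-rotC j M i zero    = refl
  fitRun-rotC j M i (suc c) rewrite fits-rotC j M i | fitRun-rotC j M (suc i) c = refl

  misfits-rotC : ∀ j M → fits M 0 j ≡ true → misfits (rotC m j M) j + 𝟙 (not (fits M k j)) ≡ misfits M j
  misfits-rotC j M top = begin
    misfits (rotC m j M) j + 𝟙 (misfit k)   ≡⟨ cong (_+ 𝟙 (misfit k))
                                                 (∑-cong k (λ i _ → cong (𝟙 ∘ not) (fits-rotC j M i))) ⟩
    count k misfit + 𝟙 (misfit k)           ≡⟨ ∑-last k (𝟙 ∘ misfit) ⟨
    count (suc k) misfit                    ≡⟨ cong (λ b → 𝟙 (not b) + misfits M j) top ⟩
    misfits M j                             ∎
    where
    open ≡-Reasoning
    misfit : ℕ → Bool
    misfit i = not (fits M i j)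

  fitRun-rotC-extends : ∀ j M c → fits M 0 j ≡ true → fitRun M j 1 c < c →
                        fitRun (rotC m j M) j 1 c ≡ suc (fitRun M j 1 c)
  fitRun-rotC-extends j M (suc c) top run<c rewrite fitRun-rotC j M 0 (suc c) | top =
    cong suc (fitRun-truncate M j 1 c run<c)

  deficit-rotC : ∀ j M → fits M 0 j ≡ true → underfull m n M j ≡ true → deficit M j ≡ suc (deficit (rotC m j M) j)
  deficit-rotC j M top uf = begin
    k ∸ fitRun M j 1 k                  ≡⟨ +-∸-assoc 1 run<k ⟩
    suc (k ∸ suc (fitRun M j 1 k))      ≡⟨ cong (λ r → suc (k ∸ r)) (fitRun-rotC-extends j M k top run<k) ⟨
    suc (k ∸ fitRun (rotC m j M) j 1 k) ∎
    where
    open ≡-Reasoning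
    run<k = underfull⇒fitRun<k M j uf

  -- One outer iteration

  deficit<m : ∀ M j → deficit M j < m
  deficit<m M j = s≤s (m∸n≤m k (fitRun M j 1 k))

  settleWith : ℕ → Mat → ℕ → Mat × ℕ
  settleWith zero    M j = M , 0
  settleWith (suc f) M j with topOK n M j ∧ underfull m n M j
  ... | false = M , 0
  ... | true  = map₂ suc (settleWith f (rotC m j M) j)

  settle : Mat → ℕ → Mat × ℕ
  settle = settleWith m

  private
    ∧≡true⇒ : ∀ {a b} → a ∧ b ≡ true → a ≡ true × b ≡ true
    ∧≡true⇒ {true} {true} _ = refl , refl

  rotates⇒deficit-drops : ∀ M j → topOK n M j ∧ underfull m n M j ≡ true → deficit M j ≡ suc (deficit (rotC m j M) j)
  rotates⇒deficit-drops M j guard = deficit-rotC j M (proj₁ (∧≡true⇒ guard)) (proj₂ (∧≡true⇒ guard))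

  rotates⇒deficit< : ∀ M j {f} → topOK n M j ∧ underfull m n M j ≡ true → deficit M j < suc f →
                     deficit (rotC m j M) j < f
  rotates⇒deficit< M j {f} guard d<f = ≤-pred (subst (_< suc f) (rotates⇒deficit-drops M j guard) d<f)

  innerLoop≡just : ∀ f M j → deficit M j < f → innerLoop m n f M j ≡ just (settleWith f M j)
  innerLoop≡just (suc f) M j d<f with topOK n M j ∧ underfull m n M j in guard
  ... | false = refl
  ... | true rewrite innerLoop≡just f (rotC m j M) j (rotates⇒deficit< M j guard d<f) = refl

  settleWith-fuel : ∀ f f′ M j → deficit M j < f → deficit M j < f′ → settleWith f M j ≡ settleWith f′ M j
  settleWith-fuel (suc f) (suc f′) M j d<f d<f′ with topOK n M j ∧ underfull m n M j in guard
  ... | false = refl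
  ... | true  = cong (map₂ suc) (settleWith-fuel f f′ (rotC m j M) j (rotates⇒deficit< M j guard d<f)
                                                                    (rotates⇒deficit< M j guard d<f′))

  settle-other : ∀ f M j i {j′} → j′ ≢ j → proj₁ (settleWith f M j) i j′ ≡ M i j′
  settle-other zero    M j i j′≢j = refl
  settle-other (suc f) M j i j′≢j with topOK n M j ∧ underfull m n M j
  ... | false = refl
  ... | true  = trans (settle-other f (rotC m j M) j i j′≢j) (rotC-other j M i j′≢j)

  settle-idle : ∀ f M j → fits M 0 j ≡ false → settleWith f M j ≡ (M , 0)
  settle-idle zero    M j _   = refl
  settle-idle (suc f) M j top rewrite top = refl

  settle-deficit : ∀ f M j → deficit M j < f →
                   deficit (proj₁ (settleWith f M j)) j + proj₂ (settleWith f M j) ≡ deficit M j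
  settle-deficit (suc f) M j d<f with topOK n M j ∧ underfull m n M j in guard
  ... | false = +-identityʳ _
  ... | true  = begin
    deficit (proj₁ R) j + suc (proj₂ R)   ≡⟨ +-suc _ _ ⟩
    suc (deficit (proj₁ R) j + proj₂ R)   ≡⟨ cong suc (settle-deficit f N j (rotates⇒deficit< M j guard d<f)) ⟩
    suc (deficit N j)                     ≡⟨ rotates⇒deficit-drops M j guard ⟨
    deficit M j                           ∎
    where
    open ≡-Reasoning
    N = rotC m j M
    R = settleWith f N j

  settle-misfits-≤ : ∀ f M j → misfits (proj₁ (settleWith f M j)) j ≤ misfits M j
  settle-misfits-≤ zero    M j = ≤-refl
  settle-misfits-≤ (suc f) M j with topOK n M j ∧ underfull m n M j in guard
  ... | false = ≤-refl
  ... | true  = ≤-trans (settle-misfits-≤ f (rotC m j M) j)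
                        (≤-trans (m≤m+n _ _) (≤-reflexive (misfits-rotC j M (proj₁ (∧≡true⇒ guard)))))

  settle-misfits-< : ∀ f M j → deficit M j < f → fits M 0 j ≡ true → 0 < misfits M j →
                     misfits (proj₁ (settleWith f M j)) j < misfits M j
  settle-misfits-< (suc f) M j d<f top 0<misfits rewrite top | misfits>0⇒underfull M j 0<misfits
    with fits M k j | misfits-rotC j M top | fits-rotC-top j M
  ... | false | shed | _      = ≤-<-trans (settle-misfits-≤ f (rotC m j M) j)
                                           (subst (misfits (rotC m j M) j <_) shed (m<m+n _ z<s))
  ... | true  | shed | newTop = subst (misfits (proj₁ (settleWith f N j)) j <_) unchanged
                                  (settle-misfits-< f N j d′<f newTop (subst (0 <_) (sym unchanged) 0<misfits))
    where
    N = rotC m j M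
    unchanged : misfits N j ≡ misfits M j
    unchanged = trans (sym (+-identityʳ _)) shed
    d′<f : deficit N j < f
    d′<f = ≤-pred (subst (_< suc f) (deficit-rotC j M top (misfits>0⇒underfull M j 0<misfits)) d<f)

  settle-misfits : ∀ M j → misfits (proj₁ (settle M j)) j ≤ misfits M j ∸ 𝟙 (fits M 0 j)
  settle-misfits M j = by-top (fits M 0 j) refl
    where
    by-top : ∀ b → fits M 0 j ≡ b → misfits (proj₁ (settle M j)) j ≤ misfits M j ∸ 𝟙 b
    by-top false top = ≤-reflexive (cong (λ R → misfits (proj₁ R) j) (settle-idle m M j top))
    by-top true  top with misfits M j in w
    ... | zero  = subst (misfits (proj₁ (settle M j)) j ≤_) w (settle-misfits-≤ m M j)
    ... | suc _ = ≤-pred (subst (misfits (proj₁ (settle M j)) j <_) w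
                    (settle-misfits-< m M j (deficit<m M j) top (subst (0 <_) (sym w) z<s)))

  SameColumn : ℕ → Mat → Mat → Set
  SameColumn j M N = ∀ i → M i j ≡ N i j

  rotC-cong : ∀ j M N → SameColumn j M N → SameColumn j (rotC m j M) (rotC m j N)
  rotC-cong j M N same zero    = trans (rotC-top j M) (trans (same k) (sym (rotC-top j N)))
  rotC-cong j M N same (suc i) = trans (rotC-body j M i) (trans (same i) (sym (rotC-body j N i)))

  guard-cong : ∀ j M N → SameColumn j M N → topOK n M j ∧ underfull m n M j ≡ topOK n N j ∧ underfull m n N j
  guard-cong j M N same = cong₂ _∧_ (cong (λ x → belongsTo x j) (same 0))
                                (cong or (map-cong (λ i → cong (λ x → not (belongsTo x j)) (same i)) (map suc (upTo k))))

  settle-cong : ∀ f j M N → SameColumn j M N → SameColumn j (proj₁ (settleWith f M j)) (proj₁ (settleWith f N j))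
  settle-cong zero    j M N same = same
  settle-cong (suc f) j M N same
    with topOK n M j ∧ underfull m n M j | topOK n N j ∧ underfull m n N j | guard-cong j M N same
  ... | false | .false | refl = same
  ... | true  | .true  | refl = settle-cong f j (rotC m j M) (rotC m j N) (rotC-cong j M N same)

  SameBody : ℕ → Mat → Mat → Set
  SameBody j M N = ∀ i → M (suc i) j ≡ N (suc i) j

  misfits-cong : ∀ j M N → SameBody j M N → misfits M j ≡ misfits N j
  misfits-cong j M N same = ∑-cong k (λ i _ → cong (λ x → 𝟙 (not (belongsTo x j))) (same i))

  deficit-cong : ∀ j M N → SameBody j M N → deficit M j ≡ deficit N j
  deficit-cong j M N same = cong (k ∸_) (run 0 k)
    where
    run : ∀ i c → fitRun M j (suc i) c ≡ fitRun N j (suc i) c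
    run i zero    = refl
    run i (suc c) rewrite same i | run (suc i) c = refl

  sweep : Mat → List ℕ → Mat × ℕ
  sweep M []       = M , 0
  sweep M (j ∷ js) = map₂ (proj₂ (settle M j) +_) (sweep (proj₁ (settle M j)) js)

  forLoop≡just : ∀ f M js → m ≤ f → forLoop m n f M js ≡ just (sweep M js)
  forLoop≡just f M []       m≤f = refl
  forLoop≡just f M (j ∷ js) m≤f
    rewrite innerLoop≡just f M j (<-≤-trans (deficit<m M j) m≤f)
          | settleWith-fuel f m M j (<-≤-trans (deficit<m M j) m≤f) (deficit<m M j)
          | forLoop≡just f (proj₁ (settle M j)) js m≤f = refl

  sweep-untouched : ∀ M js {t} → t ∉ js → SameColumn t (proj₁ (sweep M js)) M
  sweep-untouched M []       t∉js i = refl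
  sweep-untouched M (j ∷ js) t∉js i =
    trans (sweep-untouched (proj₁ (settle M j)) js (t∉js ∘ there) i) (settle-other m M j i (t∉js ∘ here))

  sweep-column : ∀ M js {t} → Unique js → t ∈ js → SameColumn t (proj₁ (sweep M js)) (proj₁ (settle M t))
  sweep-column M (j ∷ js) (j∉js ∷ _)  (here refl) =
    sweep-untouched (proj₁ (settle M j)) js (λ j∈js → All.lookup j∉js j∈js refl)
  sweep-column M (j ∷ js) {t} (j∉js ∷ uniq) (there t∈js) i =
    trans (sweep-column M₁ js uniq t∈js i) (settle-cong m t M₁ M (λ i → settle-other m M j i (j≢t ∘ sym)) i)
    where
    M₁ = proj₁ (settle M j)
    j≢t : j ≢ t
    j≢t = All.lookup j∉js t∈js

  sweep-deficit : ∀ M js → All (_< n) js → totalDeficit (proj₁ (sweep M js)) + proj₂ (sweep M js) ≡ totalDeficit M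
  sweep-deficit M []       []            = +-identityʳ _
  sweep-deficit M (j ∷ js) (j<n ∷ js<n) = begin
    totalDeficit (proj₁ S) + (r₁ + proj₂ S) ≡⟨ cong (totalDeficit (proj₁ S) +_) (+-comm r₁ _) ⟩
    totalDeficit (proj₁ S) + (proj₂ S + r₁) ≡⟨ +-assoc (totalDeficit (proj₁ S)) _ _ ⟨
    totalDeficit (proj₁ S) + proj₂ S + r₁   ≡⟨ cong (_+ r₁) (sweep-deficit M₁ js js<n) ⟩
    totalDeficit M₁ + r₁                    ≡⟨ ∑-update n j r₁ j<n (settle-deficit m M j (deficit<m M j))
                                                 (λ t _ t≢j → deficit-cong t M₁ M (λ i → settle-other m M j (suc i) t≢j)) ⟩
    totalDeficit M                          ∎
    where
    open ≡-Reasoning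
    M₁ = proj₁ (settle M j)
    r₁ = proj₂ (settle M j)
    S  = sweep M₁ js

  step : Mat → Mat
  step M = rotR n (proj₁ (sweep M (upTo n)))

  rotations : Mat → ℕ
  rotations M = proj₂ (sweep M (upTo n))

  step-column : ∀ M {t} → t < n → SameBody t (step M) (proj₁ (settle M t))
  step-column M t<n i = sweep-column M (upTo n) (upTo⁺ n) (∈-upTo⁺ t<n) (suc i)

  step-deficit : ∀ M → totalDeficit (step M) + rotations M ≡ totalDeficit M
  step-deficit M = trans (cong (_+ rotations M) (∑-cong n (λ t _ → deficit-cong t (step M) swept (λ i → refl))))
                         (sweep-deficit M (upTo n) (applyUpTo⁺₁ (λ i → i) n (λ i<n → i<n)))
    where swept = proj₁ (sweep M (upTo n))

  step-misfits : ∀ M {t} → t < n → misfits (step M) t ≤ misfits M t ∸ 𝟙 (fits M 0 t)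
  step-misfits M {t} t<n =
    subst (_≤ misfits M t ∸ 𝟙 (fits M 0 t)) (sym (misfits-cong t (step M) (proj₁ (settle M t)) (step-column M t<n)))
          (settle-misfits M t)

  step-shift : ∀ M {s} → s < n → fits M 0 s ≡ false → step M 0 (suc s) ≡ M 0 s
  step-shift M s<n misfit =
    trans (sweep-column M (upTo n) (upTo⁺ n) (∈-upTo⁺ s<n) 0) (cong (λ R → proj₁ R 0 _) (settle-idle m M _ misfit))

  -- Entries stay a permutation of 1, …, mn

  record Valid (M : Mat) : Set where
    field
      inRange  : ∀ {i j} → i < m → j < n → 1 ≤ M i j × M i j ≤ m * n
      distinct : ∀ {i j i′ j′} → i < m → j < n → i′ < m → j′ < n →
                 M i j ≡ M i′ j′ → i ≡ i′ × j ≡ j′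

  Valid-reindex : ∀ {M N} (p q : ℕ → ℕ → ℕ) →
                  (∀ {i j} → i < m → j < n → p i j < m × q i j < n) →
                  (∀ {i j i′ j′} → i < m → j < n → i′ < m → j′ < n →
                     p i j ≡ p i′ j′ → q i j ≡ q i′ j′ → i ≡ i′ × j ≡ j′) →
                  (∀ i j → N i j ≡ M (p i j) (q i j)) → Valid M → Valid N
  Valid-reindex {M} {N} p q into inj N≡M∘pq valid = record
    { inRange  = λ i<m j<n → subst (λ x → 1 ≤ x × x ≤ m * n) (sym (N≡M∘pq _ _))
                                   (inRange (proj₁ (into i<m j<n)) (proj₂ (into i<m j<n)))
    ; distinct = λ i<m j<n i′<m j′<n Nij≡Ni′j′ →
        let (p≡ , q≡) = distinct (proj₁ (into i<m j<n)) (proj₂ (into i<m j<n))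
                                 (proj₁ (into i′<m j′<n)) (proj₂ (into i′<m j′<n))
                                 (trans (sym (N≡M∘pq _ _)) (trans Nij≡Ni′j′ (N≡M∘pq _ _)))
        in inj i<m j<n i′<m j′<n p≡ q≡
    }
    where open Valid valid

  cycleIf : Bool → ℕ → ℕ → ℕ
  cycleIf false a i       = i
  cycleIf true  a zero    = a
  cycleIf true  a (suc i) = i

  cycleIf-< : ∀ b {a i} → i < suc a → cycleIf b a i < suc a
  cycleIf-< false           i<a       = i<a
  cycleIf-< true  {i = zero}  _         = ≤-refl
  cycleIf-< true  {i = suc i} (s<s i<a) = m≤n⇒m≤1+n i<a

  cycleIf-injective : ∀ b {a i i′} → i < suc a → i′ < suc a → cycleIf b a i ≡ cycleIf b a i′ → i ≡ i′
  cycleIf-injective false _ _ eq = eq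
  cycleIf-injective true {i = zero}  {zero}   _         _          _  = refl
  cycleIf-injective true {i = zero}  {suc i′} _         (s<s i′<a) eq = contradiction (sym eq) (<⇒≢ i′<a)
  cycleIf-injective true {i = suc i} {zero}   (s<s i<a) _          eq = contradiction eq (<⇒≢ i<a)
  cycleIf-injective true {i = suc i} {suc i′} _         _          eq = cong suc eq

  rotC-reindex : ∀ j M i j′ → rotC m j M i j′ ≡ M (cycleIf (j′ ≡ᵇ j) k i) j′
  rotC-reindex j M i j′ with j′ ≡ᵇ j in e
  ... | false = refl
  ... | true with ≡ᵇ≡true⇒≡ j′ j e
  rotC-reindex j M zero    .j | true | refl = refl
  rotC-reindex j M (suc i) .j | true | refl = refl

  rotR-reindex : ∀ M i j → rotR n M i j ≡ M i (cycleIf (i ≡ᵇ 0) n′ j)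
  rotR-reindex M zero    zero    = refl
  rotR-reindex M zero    (suc j) = refl
  rotR-reindex M (suc i) j       = refl

  rotC-Valid : ∀ j M → Valid M → Valid (rotC m j M)
  rotC-Valid j M = Valid-reindex (λ i j′ → cycleIf (j′ ≡ᵇ j) k i) (λ _ j′ → j′)
    (λ {i} {j′} i<m j′<n → cycleIf-< (j′ ≡ᵇ j) i<m , j′<n)
    (λ {i} {j′} {i′} i<m _ i′<m _ p≡ q≡ →
       cycleIf-injective (j′ ≡ᵇ j) i<m i′<m (trans p≡ (cong (λ x → cycleIf (x ≡ᵇ j) k i′) (sym q≡))) , q≡)
    (rotC-reindex j M)

  rotR-Valid : ∀ M → Valid M → Valid (rotR n M)
  rotR-Valid M = Valid-reindex (λ i _ → i) (λ i j → cycleIf (i ≡ᵇ 0) n′ j)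
    (λ {i} i<m j<n → i<m , cycleIf-< (i ≡ᵇ 0) j<n)
    (λ {i} {j} {i′} {j′} _ j<n _ j′<n p≡ q≡ →
       p≡ , cycleIf-injective (i ≡ᵇ 0) j<n j′<n (trans q≡ (cong (λ x → cycleIf (x ≡ᵇ 0) n′ j′) (sym p≡))))
    (rotR-reindex M)

  settle-Valid : ∀ f M j → Valid M → Valid (proj₁ (settleWith f M j))
  settle-Valid zero    M j valid = valid
  settle-Valid (suc f) M j valid with topOK n M j ∧ underfull m n M j
  ... | false = valid
  ... | true  = settle-Valid f (rotC m j M) j (rotC-Valid j M valid)

  sweep-Valid : ∀ M js → Valid M → Valid (proj₁ (sweep M js))
  sweep-Valid M []       valid = valid
  sweep-Valid M (j ∷ js) valid = sweep-Valid (proj₁ (settle M j)) js (settle-Valid m M j valid)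

  step-Valid : ∀ M → Valid M → Valid (step M)
  step-Valid M valid = rotR-Valid _ (sweep-Valid M (upTo n) valid)

  -- Entries travelling along the first row

  after : ℕ → Mat → Mat
  after d M = fold M step d

  after-Valid : ∀ d M → Valid M → Valid (after d M)
  after-Valid zero    M valid = valid
  after-Valid (suc d) M valid = step-Valid _ (after-Valid d M valid)

  target : ℕ → ℕ
  target x = (x ∸ 1) % n

  belongsTo≡ : ∀ x j → belongsTo x j ≡ (target x ≡ᵇ j)
  belongsTo≡ x j = cong (_≡ᵇ suc j) (+-comm (target x) 1)

  travel : ∀ M s d → s + d ≤ n → (∀ e → e < d → target (M 0 s) ≢ s + e) → after d M 0 (s + d) ≡ M 0 s
  travel M s zero    _       _     = cong (M 0) (+-identityʳ s)
  travel M s (suc d) s+d≤n avoid = begin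
    after (suc d) M 0 (s + suc d)    ≡⟨ cong (step (after d M) 0) (+-suc s d) ⟩
    step (after d M) 0 (suc (s + d)) ≡⟨ step-shift (after d M) (subst (_≤ n) (+-suc s d) s+d≤n) passes ⟩
    after d M 0 (s + d)              ≡⟨ arrived ⟩
    M 0 s                            ∎
    where
    open ≡-Reasoning
    arrived : after d M 0 (s + d) ≡ M 0 s
    arrived = travel M s d (≤-trans (+-monoʳ-≤ s (n≤1+n d)) s+d≤n) (λ e e<d → avoid e (m≤n⇒m≤1+n e<d))
    passes : fits (after d M) 0 (s + d) ≡ false
    passes = trans (cong (λ x → belongsTo x (s + d)) arrived)
                   (trans (belongsTo≡ (M 0 s) (s + d)) (≢⇒≡ᵇ≡false (avoid d ≤-refl)))

  delay : ℕ → ℕ → ℕ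
  delay t s with s ≤? t
  ... | yes _ = t ∸ s
  ... | no  _ = t + suc (n′ ∸ s)

  target⇒fits : ∀ X {x t} → target x ≡ t → X 0 t ≡ x → fits X 0 t ≡ true
  target⇒fits X {x} {t} tgt X0t≡x =
    trans (cong (λ y → belongsTo y t) X0t≡x) (trans (belongsTo≡ x t) (trans (cong (_≡ᵇ t) tgt) (≡ᵇ-refl t)))

  arrives-ahead : ∀ M {s t} → s ≤ t → t < n → target (M 0 s) ≡ t → after (t ∸ s) M 0 t ≡ M 0 s
  arrives-ahead M {s} {t} s≤t t<n tgt = begin
    after (t ∸ s) M 0 t             ≡⟨ cong (after (t ∸ s) M 0) (m+[n∸m]≡n s≤t) ⟨
    after (t ∸ s) M 0 (s + (t ∸ s)) ≡⟨ travel M s (t ∸ s) (≤-trans (≤-reflexive (m+[n∸m]≡n s≤t)) (<⇒≤ t<n)) avoid ⟩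
    M 0 s                           ∎
    where
    open ≡-Reasoning
    avoid : ∀ e → e < t ∸ s → target (M 0 s) ≢ s + e
    avoid e e<t∸s = subst (_≢ s + e) (sym tgt) (>⇒≢ (subst (s + e <_) (m+[n∸m]≡n s≤t) (+-monoʳ-< s e<t∸s)))

  arrives-around : ∀ M {s t} → t < s → s < n → target (M 0 s) ≡ t → after (t + suc (n′ ∸ s)) M 0 t ≡ M 0 s
  arrives-around M {s} {t} t<s s<n tgt = begin
    after (t + suc (n′ ∸ s)) M 0 t       ≡⟨ cong (λ X → X 0 t) (fold-+ M step t) ⟩
    after t (after (suc (n′ ∸ s)) M) 0 t ≡⟨ travel (after (suc (n′ ∸ s)) M) 0 t (<⇒≤ (<-trans t<s s<n)) avoid₀ ⟩
    after (suc (n′ ∸ s)) M 0 0           ≡⟨ wrapped ⟩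
    M 0 s                                ∎
    where
    open ≡-Reasoning
    s+[n−s]≡n : s + suc (n′ ∸ s) ≡ n
    s+[n−s]≡n = trans (+-suc s (n′ ∸ s)) (cong suc (m+[n∸m]≡n (≤-pred s<n)))
    -- After at least one iteration slot 0 and the out-of-range slot n both show slot n′
    -- of the swept board, so reaching slot n means reaching slot 0.
    wrapped : after (suc (n′ ∸ s)) M 0 0 ≡ M 0 s
    wrapped = trans (cong (after (suc (n′ ∸ s)) M 0) (sym s+[n−s]≡n))
                    (travel M s (suc (n′ ∸ s)) (≤-reflexive s+[n−s]≡n)
                      (λ e _ → subst (_≢ s + e) (sym tgt) (<⇒≢ (<-≤-trans t<s (m≤m+n s e)))))
    avoid₀ : ∀ e → e < t → target (after (suc (n′ ∸ s)) M 0 0) ≢ e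
    avoid₀ e e<t = subst (_≢ e) (sym (trans (cong target wrapped) tgt)) (>⇒≢ e<t)

  arrives : ∀ M {s t} → s < n → t < n → target (M 0 s) ≡ t → fits (after (delay t s) M) 0 t ≡ true
  arrives M {s} {t} s<n t<n tgt with s ≤? t
  ... | yes s≤t = target⇒fits (after (t ∸ s) M) tgt (arrives-ahead M s≤t t<n tgt)
  ... | no  s≰t = target⇒fits (after (t + suc (n′ ∸ s)) M) tgt (arrives-around M (≰⇒> s≰t) s<n tgt)

  delay<n : ∀ {t s} → t < n → s < n → delay t s < n
  delay<n {t} {s} t<n s<n with s ≤? t
  ... | yes _   = ≤-<-trans (m∸n≤m t s) t<n
  ... | no  s≰t = begin-strict
    t + suc (n′ ∸ s)   ≡⟨ +-suc t (n′ ∸ s) ⟩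
    suc (t + (n′ ∸ s)) <⟨ s<s ( +-monoˡ-< (n′ ∸ s) (≰⇒> s≰t)) ⟩
    suc (s + (n′ ∸ s)) ≡⟨ cong suc (m+[n∸m]≡n (≤-pred s<n)) ⟩
    n                  ∎
    where open ≤-Reasoning

  delay-injective : ∀ {t s s′} → s < n → s′ < n → delay t s ≡ delay t s′ → s ≡ s′
  delay-injective {t} {s} {s′} s<n s′<n eq with s ≤? t | s′ ≤? t
  ... | yes s≤t | yes s′≤t = ∸-cancelˡ-≡ s≤t s′≤t eq
  ... | no  _   | no  _    = ∸-cancelˡ-≡ (≤-pred s<n) (≤-pred s′<n) (suc-injective (+-cancelˡ-≡ t _ _ eq))
  ... | yes _   | no  _    = contradiction eq (<⇒≢ (≤-<-trans (m∸n≤m t s) (m<m+n t z<s)))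
  ... | no  _   | yes _    = contradiction (sym eq) (<⇒≢ (≤-<-trans (m∸n≤m t s′) (m<m+n t z<s)))

  belongsTo⇒target : ∀ x t → belongsTo x t ≡ true → target x ≡ t
  belongsTo⇒target x t b = ≡ᵇ≡true⇒≡ (target x) t (trans (sym (belongsTo≡ x t)) b)

  heading : Mat → ℕ → ℕ
  heading M t = count n (λ s → belongsTo (M 0 s) t)

  arrivals : Mat → ℕ → ℕ
  arrivals M t = count n (λ i → fits (after i M) 0 t)

  heading≤arrivals : ∀ M {t} → t < n → heading M t ≤ arrivals M t
  heading≤arrivals M {t} t<n = count-injection n ι
    where
    ι : Injects n (λ s → belongsTo (M 0 s) t) n (λ i → fits (after i M) 0 t)
    ι = record
      { to        = delay t
      ; maps-into = λ s s<n heads → delay<n t<n s<n , arrives M s<n t<n (belongsTo⇒target (M 0 s) t heads)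
      ; injective = λ s s′ s<n s′<n _ _ → delay-injective s<n s′<n
      }

  -- Geometric decay of the misfits

  rank : ℕ → ℕ
  rank x = (x ∸ 1) / n

  target-rank-injective : ∀ {x y} → 1 ≤ x → 1 ≤ y → target x ≡ target y → rank x ≡ rank y → x ≡ y
  target-rank-injective {x} {y} 1≤x 1≤y target≡ rank≡ = begin
    x                        ≡⟨ m∸n+n≡m 1≤x ⟨
    x ∸ 1 + 1                ≡⟨ cong (_+ 1) (m≡m%n+[m/n]*n (x ∸ 1) n) ⟩
    target x + rank x * n + 1 ≡⟨ cong₂ (λ a b → a + b * n + 1) target≡ rank≡ ⟩
    target y + rank y * n + 1 ≡⟨ cong (_+ 1) (m≡m%n+[m/n]*n (y ∸ 1) n) ⟨
    y ∸ 1 + 1                ≡⟨ m∸n+n≡m 1≤y ⟩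
    y                        ∎
    where open ≡-Reasoning

  module _ {M} (valid : Valid M) where
    open Valid valid

    rank<m : ∀ {i j} → i < m → j < n → rank (M i j) < m
    rank<m i<m j<n = m<n*o⇒m/o<n (<-≤-trans (∸-monoʳ-< z<s (proj₁ (inRange i<m j<n))) (proj₂ (inRange i<m j<n)))

    -- Only m values are aimed at t, and their ranks tell them apart.
    heading≤1+misfits : ∀ {t} → t < n → heading M t ≤ suc (misfits M t)
    heading≤1+misfits {t} t<n = +-cancelʳ-≤ (count k fitting) (heading M t) (suc (misfits M t)) (begin
      heading M t + count k fitting        ≤⟨ count-injection₂ n k rows body rows-body-disjoint ⟩
      count m (λ _ → true)                 ≡⟨ ∑-ones m ⟩
      suc k                                ≡⟨ cong suc (count-complement k fitting) ⟨
      suc (count k fitting + misfits M t)  ≡⟨ cong suc (+-comm (count k fitting) _) ⟩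
      suc (misfits M t + count k fitting)  ∎)
      where
      open ≤-Reasoning
      fitting : ℕ → Bool
      fitting i = fits M (suc i) t

      sameRank⇒samePosition : ∀ {i j i′ j′} → i < m → j < n → i′ < m → j′ < n →
                              belongsTo (M i j) t ≡ true → belongsTo (M i′ j′) t ≡ true →
                              rank (M i j) ≡ rank (M i′ j′) → i ≡ i′ × j ≡ j′
      sameRank⇒samePosition {i} {j} {i′} {j′} i<m j<n i′<m j′<n b b′ rank≡ =
        distinct i<m j<n i′<m j′<n (target-rank-injective (proj₁ (inRange i<m j<n)) (proj₁ (inRange i′<m j′<n))
          (trans (belongsTo⇒target (M i j) t b) (sym (belongsTo⇒target (M i′ j′) t b′))) rank≡)

      rows : Injects n (λ s → belongsTo (M 0 s) t) m (λ _ → true)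
      rows = record
        { to        = λ s → rank (M 0 s)
        ; maps-into = λ s s<n _ → rank<m z<s s<n , refl
        ; injective = λ s s′ s<n s′<n b b′ → proj₂ ∘ sameRank⇒samePosition z<s s<n z<s s′<n b b′
        }

      body : Injects k fitting m (λ _ → true)
      body = record
        { to        = λ i → rank (M (suc i) t)
        ; maps-into = λ i i<k _ → rank<m (s<s i<k) t<n , refl
        ; injective = λ i i′ i<k i′<k b b′ →
                        suc-injective ∘ proj₁ ∘ sameRank⇒samePosition (s<s i<k) t<n (s<s i′<k) t<n b b′
        }

      rows-body-disjoint : ∀ s i → s < n → i < k → belongsTo (M 0 s) t ≡ true → fitting i ≡ true →
                           Injects.to rows s ≢ Injects.to body i
      rows-body-disjoint s i s<n i<k b b′ rank≡ =
        case proj₁ (sameRank⇒samePosition z<s s<n (s<s i<k) t<n b b′ rank≡) of λ ()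

  n≤∑heading : ∀ M → n ≤ ∑[ t < n ] heading M t
  n≤∑heading M = begin
    n                                              ≡⟨ ∑-ones n ⟨
    ∑[ s < n ] 1                                   ≤⟨ ∑-mono-≤ n (λ s _ → count>0 n (belongsTo (M 0 s)) (target (M 0 s))
                                                        (m%n<n (M 0 s ∸ 1) n)
                                                        (trans (belongsTo≡ (M 0 s) _) (≡ᵇ-refl (target (M 0 s))))) ⟩
    ∑[ s < n ] count n (λ t → belongsTo (M 0 s) t) ≡⟨ ∑-comm n n (λ s t → 𝟙 (belongsTo (M 0 s) t)) ⟩
    ∑[ t < n ] heading M t                         ∎
    where open ≤-Reasoning

  misfits≤k : ∀ M j → misfits M j ≤ k
  misfits≤k M j = count-≤ k _

  totalMisfits-round-decay : ∀ N → Valid N →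
                             totalMisfits N + 2 * k * totalMisfits (after n N) ≤ 2 * k * totalMisfits N
  totalMisfits-round-decay N valid = +-cancelˡ-≤ (k * n) _ _ (begin
    k * n + (∑A + 2 * k * ∑B)       ≡⟨ regroupˡ ∑A ∑B k n ⟩
    ∑A + k * (n + (∑B + ∑B))        ≤⟨ +-monoʳ-≤ ∑A (*-monoʳ-≤ k (+-monoˡ-≤ (∑B + ∑B) (n≤∑heading N))) ⟩
    ∑A + k * (∑R + (∑B + ∑B))       ≡⟨ sumˡ ⟨
    ∑[ t < n ] (A t + k * (R t + (B t + B t))) ≤⟨ ∑-mono-≤ n per-column ⟩
    ∑[ t < n ] (k * (1 + (A t + A t)))         ≡⟨ sumʳ ⟩
    k * (n + (∑A + ∑A))             ≡⟨ regroupʳ ∑A k n ⟩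
    k * n + 2 * k * ∑A              ∎)
    where
    open ≤-Reasoning
    A B R : ℕ → ℕ
    A t = misfits N t
    B t = misfits (after n N) t
    R t = heading N t
    ∑A ∑B ∑R : ℕ
    ∑A = ∑< n A
    ∑B = ∑< n B
    ∑R = ∑< n R

    per-column : ∀ t → t < n → A t + k * (R t + (B t + B t)) ≤ k * (1 + (A t + A t))
    per-column t t<n = begin
      A t + k * (R t + (B t + B t))          ≤⟨ +-monoˡ-≤ _ (A≤k*[1⊓A] (A t) (misfits≤k N t)) ⟩
      k * (1 ⊓ A t) + k * (R t + (B t + B t)) ≡⟨ *-distribˡ-+ k (1 ⊓ A t) _ ⟨
      k * (1 ⊓ A t + (R t + (B t + B t)))     ≡⟨ cong (k *_) (x+[y+z]≡y+[x+z] (1 ⊓ A t) (R t) _) ⟩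
      k * (R t + (1 ⊓ A t + (B t + B t)))     ≤⟨ *-monoʳ-≤ k (column-budget (A t) (B t) (R t) B≤A∸R
                                                                    (heading≤1+misfits valid t<n)) ⟩
      k * (1 + (A t + A t))                  ∎
      where
      B≤A∸R : B t ≤ A t ∸ R t
      B≤A∸R = ≤-trans (count-decrements (λ i → misfits (after i N) t) (λ i → fits (after i N) 0 t)
                         (λ i → step-misfits (after i N) t<n) n)
                       (∸-monoʳ-≤ (A t) (heading≤arrivals N t<n))
      A≤k*[1⊓A] : ∀ a → a ≤ k → a ≤ k * (1 ⊓ a)
      A≤k*[1⊓A] zero    _   = z≤n
      A≤k*[1⊓A] (suc a) a≤k = ≤-trans a≤k (≤-reflexive (sym (*-identityʳ k)))
      x+[y+z]≡y+[x+z] : ∀ x y z → x + (y + z) ≡ y + (x + z)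
      x+[y+z]≡y+[x+z] = solve-∀

    sumˡ : ∑[ t < n ] (A t + k * (R t + (B t + B t))) ≡ ∑A + k * (∑R + (∑B + ∑B))
    sumˡ = begin-equality
      ∑[ t < n ] (A t + k * (R t + (B t + B t))) ≡⟨ ∑-distrib-+ n A (λ t → k * (R t + (B t + B t))) ⟩
      ∑A + ∑[ t < n ] (k * (R t + (B t + B t)))  ≡⟨ cong (∑A +_) (∑-distribˡ-* n k (λ t → R t + (B t + B t))) ⟩
      ∑A + k * ∑[ t < n ] (R t + (B t + B t))    ≡⟨ cong (λ x → ∑A + k * x) (trans (∑-distrib-+ n R (λ t → B t + B t))
                                                                                (cong (∑R +_) (∑-distrib-+ n B B))) ⟩
      ∑A + k * (∑R + (∑B + ∑B))                  ∎

    sumʳ : ∑[ t < n ] (k * (1 + (A t + A t))) ≡ k * (n + (∑A + ∑A))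
    sumʳ = begin-equality
      ∑[ t < n ] (k * (1 + (A t + A t)))          ≡⟨ ∑-distribˡ-* n k (λ t → 1 + (A t + A t)) ⟩
      k * ∑[ t < n ] (1 + (A t + A t))            ≡⟨ cong (k *_) (∑-distrib-+ n (λ _ → 1) (λ t → A t + A t)) ⟩
      k * (∑[ t < n ] 1 + ∑[ t < n ] (A t + A t)) ≡⟨ cong₂ (λ x y → k * (x + y)) (∑-ones n) (∑-distrib-+ n A A) ⟩
      k * (n + (∑A + ∑A))                         ∎

    regroupˡ : ∀ a b k n → k * n + (a + 2 * k * b) ≡ a + k * (n + (b + b))
    regroupˡ = solve-∀
    regroupʳ : ∀ a k n → k * (n + (a + a)) ≡ k * n + 2 * k * a
    regroupʳ = solve-∀

  misfits-vanish : ∀ M → Valid M → .{{_ : NonZero k}} → ∀ h → totalMisfits M < 2 ^ h →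
                   totalMisfits (after (2 * k * h * n) M) ≡ 0
  misfits-vanish M valid = decay⇒vanishes V (2 * k) {{m*n≢0 2 k}} round
    where
    V : ℕ → ℕ
    V j = totalMisfits (after (j * n) M)
    round : ∀ j → V j + 2 * k * V (suc j) ≤ 2 * k * V j
    round j = subst (λ X → V j + 2 * k * totalMisfits X ≤ 2 * k * V j) (sym (fold-+ M step n))
                    (totalMisfits-round-decay (after (j * n) M) (after-Valid (j * n) M valid))

  -- Termination and the number of rotations

  ¬existsUnderfull⇒AllNearFull : ∀ M → existsUnderfull m n M ≡ false → AllNearFull m n M
  ¬existsUnderfull⇒AllNearFull M none i j 1≤i with toℕ i | toℕ<n i
  ... | suc i′ | s<s i′<k = ≡ᵇ≡true⇒≡ _ _ (not≡false⇒≡true (underfull≡false⇒ M (toℕ j)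
                              (any-applyUpTo≡false⇒ (underfull m n M) (λ x → x) n none (toℕ j) (toℕ<n j)) i′ i′<k))
    where
    not≡false⇒≡true : ∀ {b} → not b ≡ false → b ≡ true
    not≡false⇒≡true {true} _ = refl

  totalMisfits≡0⇒¬existsUnderfull : ∀ M → totalMisfits M ≡ 0 → existsUnderfull m n M ≡ false
  totalMisfits≡0⇒¬existsUnderfull M none =
    any-applyUpTo≡false⇐ (underfull m n M) (λ x → x) n
      (λ j j<n → misfits≡0⇒¬underfull M j (∑≡0⇒ n (misfits M) none j j<n))

  -- Each outer iteration uses one unit of fuel, and its inner loops need fuel above
  -- their deficit, which is below m.
  fillColumns-run : ∀ K f M → K + m < f → totalMisfits (iterate step M K) ≡ 0 →
                    ∃ λ M′ → ∃ λ r →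
                      fillColumns m n f M ≡ just (M′ , r) × r ≤ totalDeficit M + K × AllNearFull m n M′
  fillColumns-run K (suc f) M K+m<f done with existsUnderfull m n M in ex
  ... | false = M , 0 , refl , z≤n , ¬existsUnderfull⇒AllNearFull M ex
  fillColumns-run zero    (suc f) M _     done | true =
    contradiction (trans (sym ex) (totalMisfits≡0⇒¬existsUnderfull M done)) λ ()
  fillColumns-run (suc K) (suc f) M K+m<f done | true
    rewrite forLoop≡just f M (upTo n) (≤-trans (m≤n+m m (suc K)) (≤-pred K+m<f))
    with fillColumns-run K f (step M) (≤-pred K+m<f) done
  ... | M′ , r , run , r≤ , full rewrite run = M′ , rotations M + suc r , refl , bound , full
    where
    bound : rotations M + suc r ≤ totalDeficit M + suc K
    bound = begin
      rotations M + suc r                          ≡⟨ +-suc (rotations M) r ⟩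
      suc (rotations M + r)                        ≤⟨ s≤s (+-monoʳ-≤ (rotations M) r≤) ⟩
      suc (rotations M + (totalDeficit (step M) + K)) ≡⟨ cong suc (trans (sym (+-assoc (rotations M) _ K))
                                                                         (cong (_+ K) (+-comm (rotations M) _))) ⟩
      suc (totalDeficit (step M) + rotations M + K) ≡⟨ cong (λ x → suc (x + K)) (step-deficit M) ⟩
      suc (totalDeficit M + K)                     ≡⟨ +-suc (totalDeficit M) K ⟨
      totalDeficit M + suc K                       ∎
      where open ≤-Reasoning

  totalMisfits≤n*k : ∀ M → totalMisfits M ≤ n * k
  totalMisfits≤n*k M = ≤-trans (∑-mono-≤ n (λ j _ → misfits≤k M j)) (≤-reflexive (∑-const n k))

  totalDeficit≤n*k : ∀ M → totalDeficit M ≤ n * k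
  totalDeficit≤n*k M = ≤-trans (∑-mono-≤ n (λ j _ → m∸n≤m k (fitRun M j 1 k))) (≤-reflexive (∑-const n k))

  toMat-Valid : ∀ A → IsPermMatrix m n A → Valid (toMat m n A)
  toMat-Valid A (inRange , distinct , _) = record
    { inRange  = λ i<m j<n → subst (λ x → 1 ≤ x × x ≤ m * n) (sym (entry i<m j<n)) (inRange _ _)
    ; distinct = λ {i} {j} {i′} {j′} i<m j<n i′<m j′<n eq →
        let (a≡ , b≡) = distinct _ _ _ _ (trans (sym (entry i<m j<n)) (trans eq (entry i′<m j′<n)))
        in fromℕ<-injective i i′ i<m i′<m a≡ , fromℕ<-injective j j′ j<n j′<n b≡
    }
    where
    entry : ∀ {i j} (i<m : i < m) (j<n : j < n) → toMat m n A i j ≡ A (fromℕ< i<m) (fromℕ< j<n)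
    entry {i} {j} i<m j<n with i <? m | j <? n
    ... | yes _ | yes _ = refl
    ... | no ¬p | _     = contradiction i<m ¬p
    ... | yes _ | no ¬q = contradiction j<n ¬q

n<2^[1+⌊log₂n⌋] : ∀ n → n < 2 ^ suc ⌊log₂ n ⌋
n<2^[1+⌊log₂n⌋] n with n <? 2 ^ suc ⌊log₂ n ⌋
... | yes n<2^ = n<2^
... | no  n≮2^ = contradiction (subst (_≤ ⌊log₂ n ⌋) (⌊log₂[2^n]⌋≡n (suc ⌊log₂ n ⌋)) (⌊log₂⌋-mono-≤ (≮⇒≥ n≮2^)))
                              (<⇒≱ ≤-refl)

module _ (k₀ n′ : ℕ) where
  open Board (suc k₀) n′

  fillColumns-bound : m ≤ n → (A : Fin m → Fin n → ℕ) → IsPermMatrix m n A →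
    ∃ λ (fuel : ℕ) → ∃ λ (M′ : Mat) → ∃ λ (r : ℕ) →
      fillColumns m n fuel (toMat m n A) ≡ just (M′ , r) × r ≤ 9 * m * n * ⌊log₂ n ⌋ × AllNearFull m n M′
  fillColumns-bound m≤n A perm =
    let (M′ , r , run , r≤ , full) = fillColumns-run K (suc (K + m)) M₀ ≤-refl vanished
    in suc (K + m) , M′ , r , run , ≤-trans r≤ rotations-bound , full
    where
    M₀ = toMat m n A
    L = ⌊log₂ n ⌋
    h = suc L + suc L
    K = 2 * suc k₀ * h * n
    valid = toMat-Valid A perm
    initially-small : totalMisfits M₀ < 2 ^ h
    initially-small = begin-strict
      totalMisfits M₀        ≤⟨ totalMisfits≤n*k M₀ ⟩
      n * suc k₀             <⟨ *-monoʳ-< n m≤n ⟩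
      n * n                  ≤⟨ *-mono-≤ (<⇒≤ (n<2^[1+⌊log₂n⌋] n)) (<⇒≤ (n<2^[1+⌊log₂n⌋] n)) ⟩
      2 ^ suc L * 2 ^ suc L  ≡⟨ ^-distribˡ-+-* 2 (suc L) (suc L) ⟨
      2 ^ h                  ∎
      where open ≤-Reasoning
    vanished : totalMisfits (iterate step M₀ K) ≡ 0
    vanished = trans (cong totalMisfits (sym (iterate-is-fold M₀ step K))) (misfits-vanish M₀ valid h initially-small)
    rotations-bound : totalDeficit M₀ + K ≤ 9 * m * n * L
    rotations-bound = ≤-trans (+-monoˡ-≤ K (totalDeficit≤n*k M₀))
      (running-time-arithmetic m n (suc k₀) L (⌊log₂⌋-mono-≤ {2} (≤-trans (s≤s (s≤s z≤n)) m≤n)) (n≤1+n (suc k₀)))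

corollary5 : ∃ λ (c : ℕ) → 0 < c × ((m n : ℕ) → 2 ≤ m → m ≤ n → (A : Fin m → Fin n → ℕ) → IsPermMatrix m n A →
    ∃ λ (fuel : ℕ) → ∃ λ (M' : Mat) → ∃ λ (r : ℕ) →
      fillColumns m n fuel (toMat m n A) ≡ just (M' , r) × r ≤ c * m * n * ⌊log₂ n ⌋ × AllNearFull m n M')
corollary5 = 9 , z<s , λ where
  (suc (suc k₀)) (suc n′) _ m≤n → fillColumns-bound k₀ n′ m≤n
  (suc zero) _ (s≤s ())
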